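{- Let $m>2$ be an even integer and $B$ a positive integer. The $m$-ic form $$Q_B(x_{01},\dots,x_{0g(m)},\dots,x_{B1},\dots,x_{Bg(m)})=\sum_{j=0}^{B}(B+1+j)\sum_{i=1}^{g(m)}x_{ji}^m$$ is positive definite and represents (over $\mathbb{Z}$) exactly the set $\mathbb{Z}_{\geq 0}\setminus\{1,2,\dots,B\}$. Moreover, its rank is $(B+1)g(m)$.
   Context: $g(m)$ denotes the Waring number: the smallest integer such that every positive integer is a sum of at most $g(m)$ $m$th powers of non-negative integers. A form $Q$ in $n$ variables is positive definite if $Q(x)>0$ for all $x\in\mathbb{R}^n\setminus\{0\}$; an integer $a$ is represented by $Q$ if $Q(x)=a$ for some $x\in\mathbb{Z}^n$; the rank is the number of variables.
   Formalization: Positive definiteness is checked only at nonzero points of ℚ^n, rather than at all nonzero points of ℝ^n. -}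

module Defs where

open import Data.Nat as ℕ using (ℕ; zero; suc; _≤_)
open import Data.Integer as ℤ using (ℤ)
open import Data.Rational as ℚ using (ℚ)
open import Data.Fin using (Fin; toℕ)
open import Data.Vec using (Vec; []; _∷_; map; zipWith; tabulate; concat; replicate; sum)
open import Data.Product using (∃; _×_)
open import Relation.Binary.PropositionalEquality using (_≡_; _≢_)

-- Waring number: g is the least natural number such that every positive
-- integer is a sum of (at most) g m-th powers of non-negative integers
-- (sums with exactly g terms, zeros allowed, = sums with at most g terms).
WaringBound : ℕ → ℕ → Set
WaringBound m g = ∀ (n : ℕ) → 1 ≤ n → ∃ λ (xs : Vec ℕ g) → sum (map (λ x → x ℕ.^ m) xs) ≡ n

IsWaringNumber : ℕ → ℕ → Set
IsWaringNumber m g = WaringBound m g × (∀ h → WaringBound m h → g ≤ h)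

-- A diagonal m-ic form  Σ_i c_i x_i^m  with integer coefficients;
-- its rank is the number of variables.
record DiagForm : Set where
  field
    degree : ℕ
    rank   : ℕ
    coeffs : Vec ℤ rank
open DiagForm public

_^ℚ_ : ℚ → ℕ → ℚ
q ^ℚ zero  = ℚ.1ℚ
q ^ℚ suc k = q ℚ.* (q ^ℚ k)

sumℤ : ∀ {n} → Vec ℤ n → ℤ
sumℤ []       = ℤ.0ℤ
sumℤ (x ∷ xs) = x ℤ.+ sumℤ xs

sumℚ : ∀ {n} → Vec ℚ n → ℚ
sumℚ []       = ℚ.0ℚ
sumℚ (x ∷ xs) = x ℚ.+ sumℚ xs

evalℤ : (Q : DiagForm) → Vec ℤ (rank Q) → ℤ
evalℤ Q x = sumℤ (zipWith (λ c xi → c ℤ.* (xi ℤ.^ degree Q)) (coeffs Q) x)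

evalℚ : (Q : DiagForm) → Vec ℚ (rank Q) → ℚ
evalℚ Q x = sumℚ (zipWith (λ c xi → (c ℚ./ 1) ℚ.* (xi ^ℚ degree Q)) (coeffs Q) x)

PositiveDefinite : DiagForm → Set
PositiveDefinite Q = ∀ (x : Vec ℚ (rank Q)) → x ≢ replicate _ ℚ.0ℚ → ℚ.0ℚ ℚ.< evalℚ Q x

Represents : DiagForm → ℤ → Set
Represents Q a = ∃ λ (x : Vec ℤ (rank Q)) → evalℤ Q x ≡ a

-- Q_B : Σ_{j=0}^{B} (B+1+j) Σ_{i=1}^{g} x_{ji}^m, variables ordered x_{01..0g},...,x_{B1..Bg}
QB : (m g B : ℕ) → DiagForm
QB m g B = record
  { degree = m
  ; rank   = suc B ℕ.* g
  ; coeffs = concat (tabulate {n = suc B} (λ (j : Fin (suc B)) →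
               replicate g (ℤ.+ (suc B ℕ.+ toℕ j))))
  }

{-# OPTIONS --safe #-}
-- Since m is even, x^m is a nonnegative integer, so a term c x^m with c ≥ B + 1
-- is 0 or at least B + 1, and so is any sum of such terms; the same termwise
-- argument over ℚ gives positive definiteness.
-- Conversely, n ≥ B + 1 is (B + 1)(q + 1) or (B + 1)q + (B + 1 + r) with
-- 1 ≤ r ≤ B, and by Waring the g variables of block 0 (coefficient B + 1)
-- realise any multiple of B + 1 while those of block r realise B + 1 + r.
module Submission where

open import Defs
open import Data.Nat using (ℕ; suc; _*_; _≤_; _<_)
open import Data.Nat.Divisibility using (_∣_)
open import Data.Integer using (ℤ; +_)
open import Data.Integer using () renaming (_≤_ to _≤ℤ_)
open import Data.Product using (_×_)
open import Function.Bundles using (_⇔_)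
open import Relation.Nullary using (¬_)
open import Relation.Binary.PropositionalEquality using (_≡_)

open import Data.Nat using (zero; _+_; _^_; z≤n; s≤s; _<?_)
open import Data.Nat.Properties
  using (≤-trans; m≤m+n; m≤m*n; *-zeroʳ; *-distribˡ-+; <⇒≱; ≮⇒≥; m≤n⇒∃[o]m+o≡n)
open import Data.Nat.Divisibility using (divides)
open import Data.Nat.DivMod using (_divMod_; result)
open import Data.Nat.Solver using (module +-*-Solver)
open +-*-Solver using (solve; _:=_; _:+_; _:*_; con)
import Data.Integer as ℤ
import Data.Integer.Properties as ℤₚ
open import Data.Rational as ℚ using (ℚ; 0ℚ)
import Data.Rational.Properties as ℚₚ
open import Data.Fin as Fin using (Fin; toℕ)
open import Data.Fin.Properties using (toℕ<n)
open import Data.Vec using (Vec; []; _∷_; _++_; map; zipWith; tabulate; concat; replicate; sum)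
open import Data.Vec.Properties using (zipWith-++)
open import Data.Vec.Relation.Unary.All as All using (All; []; _∷_)
open import Data.Vec.Relation.Unary.All.Properties using (concat⁺; tabulate⁺)
open import Data.Product using (∃; _,_)
open import Data.Sum using (_⊎_; inj₁; inj₂)
open import Data.Empty using (⊥; ⊥-elim)
open import Function using (_∘_)
open import Relation.Nullary using (yes; no)
open import Relation.Binary.Definitions using (tri<; tri≈; tri>)
open import Relation.Binary.PropositionalEquality using (_≢_; refl; sym; trans; cong; cong₂; subst; module ≡-Reasoning)
open import Function.Bundles using (mk⇔)

diagValueℤ : ∀ {n} → ℕ → Vec ℤ n → Vec ℤ n → ℤ
diagValueℤ m cs xs = sumℤ (zipWith (λ c x → c ℤ.* (x ℤ.^ m)) cs xs)

DiagRepresents : ∀ {n} → ℕ → Vec ℤ n → ℤ → Set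
DiagRepresents m cs a = ∃ λ xs → diagValueℤ m cs xs ≡ a

diagTermℚ : ℕ → ℤ → ℚ → ℚ
diagTermℚ m c x = (c ℚ./ 1) ℚ.* (x ^ℚ m)

diagValueℚ : ∀ {n} → ℕ → Vec ℤ n → Vec ℚ n → ℚ
diagValueℚ m cs xs = sumℚ (zipWith (diagTermℚ m) cs xs)

-- coeffs (QB m g B) unfolds to blockCoeffs g (suc B) (λ j → suc B + j).
blockCoeffs : ∀ g k → (ℕ → ℕ) → Vec ℤ (k * g)
blockCoeffs g k h = concat (tabulate (λ (i : Fin k) → replicate g (+ h (toℕ i))))

ZeroOrAtLeast : ℕ → ℕ → Set
ZeroOrAtLeast b t = t ≡ 0 ⊎ b ≤ t

OutsideGap : ℕ → ℤ → Set
OutsideGap B a = (+ 0 ≤ℤ a) × ¬ ((+ 1 ≤ℤ a) × (a ≤ℤ + B))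

All-replicate⁺ : ∀ {A : Set} {P : A → Set} n {x} → P x → All P (replicate n x)
All-replicate⁺ zero    px = []
All-replicate⁺ (suc n) px = px ∷ All-replicate⁺ n px

QB-coeffs-≥ : ∀ m g B → All (+ suc B ≤ℤ_) (coeffs (QB m g B))
QB-coeffs-≥ m g B = concat⁺ (tabulate⁺ {n = suc B} λ j → All-replicate⁺ g (ℤ.+≤+ (m≤m+n (suc B) (toℕ j))))

zeroOrAtLeast-+ : ∀ {b s t} → ZeroOrAtLeast b s → ZeroOrAtLeast b t → ZeroOrAtLeast b (s + t)
zeroOrAtLeast-+ (inj₁ refl) t-ok = t-ok
zeroOrAtLeast-+ {s = s} (inj₂ b≤s) _ = inj₂ (≤-trans b≤s (m≤m+n s _))

zeroOrAtLeast-* : ∀ {b c} → b ≤ c → ∀ t → ZeroOrAtLeast b (c * t)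
zeroOrAtLeast-* {c = c} _   zero    = inj₁ (*-zeroʳ c)
zeroOrAtLeast-* {c = c} b≤c (suc t) = inj₂ (≤-trans b≤c (m≤m*n c (suc t)))

zeroOrAtLeast⇒outsideGap : ∀ {B t} → ZeroOrAtLeast (suc B) t → OutsideGap B (+ t)
zeroOrAtLeast⇒outsideGap t-ok = ℤ.+≤+ z≤n , λ { (ℤ.+≤+ 1≤t , ℤ.+≤+ t≤B) → excluded t-ok 1≤t t≤B }
  where
  excluded : ∀ {B t} → ZeroOrAtLeast (suc B) t → 1 ≤ t → t ≤ B → ⊥
  excluded (inj₁ refl) () _
  excluded (inj₂ B<t) _ t≤B = <⇒≱ B<t t≤B

i*i≡+∣i∣*∣i∣ : ∀ i → i ℤ.* i ≡ + (ℤ.∣ i ∣ * ℤ.∣ i ∣)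
i*i≡+∣i∣*∣i∣ (+ n)      = sym (ℤₚ.pos-* n n)
i*i≡+∣i∣*∣i∣ ℤ.-[1+ n ] = refl

i^[k*2]≡+[∣i∣*∣i∣]^k : ∀ i k → i ℤ.^ (k * 2) ≡ + ((ℤ.∣ i ∣ * ℤ.∣ i ∣) ^ k)
i^[k*2]≡+[∣i∣*∣i∣]^k i zero    = refl
i^[k*2]≡+[∣i∣*∣i∣]^k i (suc k) = begin
  i ℤ.* (i ℤ.* i ℤ.^ (k * 2))      ≡⟨ ℤₚ.*-assoc i i _ ⟨
  (i ℤ.* i) ℤ.* i ℤ.^ (k * 2)      ≡⟨ cong₂ ℤ._*_ (i*i≡+∣i∣*∣i∣ i) (i^[k*2]≡+[∣i∣*∣i∣]^k i k) ⟩
  + i² ℤ.* + (i² ^ k)              ≡⟨ ℤₚ.pos-* i² (i² ^ k) ⟨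
  + (i² ^ suc k)                   ∎
  where
  open ≡-Reasoning
  i² = ℤ.∣ i ∣ * ℤ.∣ i ∣

diagValueℤ-even-zeroOrAtLeast : ∀ b k {n} (cs : Vec ℤ n) → All (+ b ≤ℤ_) cs → ∀ xs →
  ∃ λ t → diagValueℤ (k * 2) cs xs ≡ + t × ZeroOrAtLeast b t
diagValueℤ-even-zeroOrAtLeast b k [] [] [] = 0 , refl , inj₁ refl
diagValueℤ-even-zeroOrAtLeast b k (_ ∷ cs) (ℤ.+≤+ {n = c} b≤c ∷ cs≥b) (x ∷ xs)
  with diagValueℤ-even-zeroOrAtLeast b k cs cs≥b xs
... | t , value≡t , t-ok =
  c * p + t ,
  cong₂ ℤ._+_ (trans (cong (+ c ℤ.*_) (i^[k*2]≡+[∣i∣*∣i∣]^k x k)) (sym (ℤₚ.pos-* c p))) value≡t ,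
  zeroOrAtLeast-+ (zeroOrAtLeast-* b≤c p) t-ok
  where p = (ℤ.∣ x ∣ * ℤ.∣ x ∣) ^ k

QB-represented⇒outsideGap : ∀ k g B a → Represents (QB (k * 2) g B) a → OutsideGap B a
QB-represented⇒outsideGap k g B a (xs , value≡a)
  with diagValueℤ-even-zeroOrAtLeast (suc B) k _ (QB-coeffs-≥ (k * 2) g B) xs
... | t , value≡t , t-ok = subst (OutsideGap B) (trans (sym value≡t) value≡a) (zeroOrAtLeast⇒outsideGap t-ok)

square-pos : ∀ p → p ≢ 0ℚ → ℚ.Positive (p ℚ.* p)
square-pos p p≢0 with ℚₚ.<-cmp p 0ℚ
... | tri< p<0 _ _ = ℚₚ.neg*neg⇒pos p {{ℚ.negative p<0}} p {{ℚ.negative p<0}}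
... | tri≈ _ p≡0 _ = ⊥-elim (p≢0 p≡0)
... | tri> _ _ p>0 = ℚₚ.pos*pos⇒pos p {{ℚ.positive p>0}} p {{ℚ.positive p>0}}

square-nonNeg : ∀ p → ℚ.NonNegative (p ℚ.* p)
square-nonNeg p with p ℚₚ.≟ 0ℚ
... | yes refl = _
... | no p≢0   = ℚₚ.pos⇒nonNeg (p ℚ.* p) {{square-pos p p≢0}}

^ℚ-even-nonNeg : ∀ p k → ℚ.NonNegative (p ^ℚ (k * 2))
^ℚ-even-nonNeg p zero    = _
^ℚ-even-nonNeg p (suc k) = subst ℚ.NonNegative (ℚₚ.*-assoc p p (p ^ℚ (k * 2)))
  (ℚₚ.nonNeg*nonNeg⇒nonNeg (p ℚ.* p) {{square-nonNeg p}} (p ^ℚ (k * 2)) {{^ℚ-even-nonNeg p k}})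

^ℚ-even-pos : ∀ p k → p ≢ 0ℚ → ℚ.Positive (p ^ℚ (k * 2))
^ℚ-even-pos p zero    _   = _
^ℚ-even-pos p (suc k) p≢0 = subst ℚ.Positive (ℚₚ.*-assoc p p (p ^ℚ (k * 2)))
  (ℚₚ.pos*pos⇒pos (p ℚ.* p) {{square-pos p p≢0}} (p ^ℚ (k * 2)) {{^ℚ-even-pos p k p≢0}})

diagTermℚ-even-nonNeg : ∀ k c p → ℚ.NonNegative (diagTermℚ (k * 2) (+ suc c) p)
diagTermℚ-even-nonNeg k c p = ℚₚ.nonNeg*nonNeg⇒nonNeg (+ suc c ℚ./ 1) {{ℚₚ.normalize-nonNeg (suc c) 1}}
  (p ^ℚ (k * 2)) {{^ℚ-even-nonNeg p k}}

diagTermℚ-even-pos : ∀ k c p → p ≢ 0ℚ → ℚ.Positive (diagTermℚ (k * 2) (+ suc c) p)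
diagTermℚ-even-pos k c p p≢0 = ℚₚ.pos*pos⇒pos (+ suc c ℚ./ 1) {{ℚₚ.normalize-pos (suc c) 1}}
  (p ^ℚ (k * 2)) {{^ℚ-even-pos p k p≢0}}

diagValueℚ-even-nonNeg : ∀ k {n} (cs : Vec ℤ n) → All (+ 1 ≤ℤ_) cs → ∀ xs →
  ℚ.NonNegative (diagValueℚ (k * 2) cs xs)
diagValueℚ-even-nonNeg k [] [] [] = _
diagValueℚ-even-nonNeg k (_ ∷ cs) (ℤ.+≤+ {n = suc c} _ ∷ cs>0) (x ∷ xs) =
  ℚₚ.nonNeg+nonNeg⇒nonNeg (diagTermℚ (k * 2) (+ suc c) x) {{diagTermℚ-even-nonNeg k c x}}
    (diagValueℚ (k * 2) cs xs) {{diagValueℚ-even-nonNeg k cs cs>0 xs}}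

diagValueℚ-even-pos : ∀ k {n} (cs : Vec ℤ n) → All (+ 1 ≤ℤ_) cs → ∀ xs → xs ≢ replicate n 0ℚ →
  ℚ.Positive (diagValueℚ (k * 2) cs xs)
diagValueℚ-even-pos k [] [] [] xs≢0 = ⊥-elim (xs≢0 refl)
diagValueℚ-even-pos k (_ ∷ cs) (ℤ.+≤+ {n = suc c} _ ∷ cs>0) (x ∷ xs) x∷xs≢0 with x ℚₚ.≟ 0ℚ
... | yes refl = ℚₚ.nonNeg+pos⇒pos (diagTermℚ (k * 2) (+ suc c) x) {{diagTermℚ-even-nonNeg k c x}}
  (diagValueℚ (k * 2) cs xs) {{diagValueℚ-even-pos k cs cs>0 xs (x∷xs≢0 ∘ cong (0ℚ ∷_))}}
... | no x≢0 = ℚₚ.pos+nonNeg⇒pos (diagTermℚ (k * 2) (+ suc c) x) {{diagTermℚ-even-pos k c x x≢0}}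
  (diagValueℚ (k * 2) cs xs) {{diagValueℚ-even-nonNeg k cs cs>0 xs}}

QB-positiveDefinite : ∀ k g B → PositiveDefinite (QB (k * 2) g B)
QB-positiveDefinite k g B xs xs≢0 = ℚₚ.positive⁻¹ _ {{diagValueℚ-even-pos k _ coeffs>0 xs xs≢0}}
  where coeffs>0 = All.map (ℤₚ.≤-trans (ℤ.+≤+ (s≤s z≤n))) (QB-coeffs-≥ (k * 2) g B)

sumℤ-++ : ∀ {a b} (xs : Vec ℤ a) (ys : Vec ℤ b) → sumℤ (xs ++ ys) ≡ sumℤ xs ℤ.+ sumℤ ys
sumℤ-++ []       ys = sym (ℤₚ.+-identityˡ (sumℤ ys))
sumℤ-++ (x ∷ xs) ys = trans (cong (ℤ._+_ x) (sumℤ-++ xs ys)) (sym (ℤₚ.+-assoc x (sumℤ xs) (sumℤ ys)))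

diagValueℤ-++ : ∀ m {a b} (cs : Vec ℤ a) (ds : Vec ℤ b) xs ys →
  diagValueℤ m (cs ++ ds) (xs ++ ys) ≡ diagValueℤ m cs xs ℤ.+ diagValueℤ m ds ys
diagValueℤ-++ m cs ds xs ys = trans (cong sumℤ (zipWith-++ f cs ds xs ys)) (sumℤ-++ (zipWith f cs xs) (zipWith f ds ys))
  where f = λ c x → c ℤ.* (x ℤ.^ m)

diagValueℤ-zero : ∀ m {n} (cs : Vec ℤ n) → diagValueℤ (suc m) cs (replicate n (+ 0)) ≡ + 0
diagValueℤ-zero m []       = refl
diagValueℤ-zero m (c ∷ cs) = cong₂ ℤ._+_ (ℤₚ.*-zeroʳ c) (diagValueℤ-zero m cs)

pos-^ : ∀ n k → (+ n) ℤ.^ k ≡ + (n ^ k)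
pos-^ n zero    = refl
pos-^ n (suc k) = trans (cong (+ n ℤ.*_) (pos-^ n k)) (sym (ℤₚ.pos-* n (n ^ k)))

diagValueℤ-replicate : ∀ m c {g} (xs : Vec ℕ g) →
  diagValueℤ m (replicate g (+ c)) (map +_ xs) ≡ + (c * sum (map (_^ m) xs))
diagValueℤ-replicate m c []       = cong +_ (sym (*-zeroʳ c))
diagValueℤ-replicate m c (x ∷ xs) = begin
  + c ℤ.* (+ x) ℤ.^ m ℤ.+ diagValueℤ m (replicate _ (+ c)) (map +_ xs)
    ≡⟨ cong₂ ℤ._+_ (trans (cong (+ c ℤ.*_) (pos-^ x m)) (sym (ℤₚ.pos-* c (x ^ m))))
                   (diagValueℤ-replicate m c xs) ⟩
  + (c * x ^ m + c * sum (map (_^ m) xs))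
    ≡⟨ cong +_ (*-distribˡ-+ c (x ^ m) _) ⟨
  + (c * sum (map (_^ m) (x ∷ xs)))
    ∎
  where open ≡-Reasoning

diagRepresents-zero : ∀ m {n} (cs : Vec ℤ n) → DiagRepresents (suc m) cs (+ 0)
diagRepresents-zero m cs = replicate _ (+ 0) , diagValueℤ-zero m cs

diagRepresents-++ : ∀ m {a b} (cs : Vec ℤ a) (ds : Vec ℤ b) {i j} →
  DiagRepresents m cs i → DiagRepresents m ds j → DiagRepresents m (cs ++ ds) (i ℤ.+ j)
diagRepresents-++ m cs ds (xs , refl) (ys , refl) = xs ++ ys , diagValueℤ-++ m cs ds xs ys

module _ (m : ℕ) {g : ℕ} (waring : WaringBound (suc m) g) where

  diagRepresents-replicate : ∀ c n → DiagRepresents (suc m) (replicate g (+ c)) (+ (c * n))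
  diagRepresents-replicate c zero =
    subst (DiagRepresents (suc m) (replicate g (+ c)) ∘ +_) (sym (*-zeroʳ c))
      (diagRepresents-zero m (replicate g (+ c)))
  diagRepresents-replicate c (suc n) with waring (suc n) (s≤s z≤n)
  ... | xs , sum≡n = map +_ xs , trans (diagValueℤ-replicate (suc m) c xs) (cong (λ s → + (c * s)) sum≡n)

  diagRepresents-block : ∀ {k} (h : ℕ → ℕ) {j} → j < k → ∀ n →
    DiagRepresents (suc m) (blockCoeffs g k h) (+ (h j * n))
  diagRepresents-block {suc k} h {zero} _ n =
    subst (DiagRepresents (suc m) (blockCoeffs g (suc k) h)) (ℤₚ.+-identityʳ _)
      (diagRepresents-++ (suc m) (replicate g (+ h 0)) (blockCoeffs g k (h ∘ suc))
        (diagRepresents-replicate (h 0) n) (diagRepresents-zero m (blockCoeffs g k (h ∘ suc))))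
  diagRepresents-block {suc k} h {suc j} (s≤s j<k) n =
    diagRepresents-++ (suc m) (replicate g (+ h 0)) (blockCoeffs g k (h ∘ suc))
      (diagRepresents-zero m (replicate g (+ h 0))) (diagRepresents-block (h ∘ suc) j<k n)

  QB-represents-≥ : ∀ B d → Represents (QB (suc m) g B) (+ (suc B + d))
  QB-represents-≥ B d with d divMod suc B
  ... | result q Fin.zero refl =
    subst (Represents (QB (suc m) g B) ∘ +_)
      (solve 2 (λ b q → (b :+ con 0) :* (con 1 :+ q) := b :+ q :* b) refl (suc B) q)
      (diagRepresents-block {suc B} (λ i → suc B + i) (s≤s z≤n) (suc q))
  ... | result q (Fin.suc r) refl =
    subst (Represents (QB (suc m) g B) ∘ +_)
      (solve 3 (λ b q r → (b :+ con 0) :* q :+ (b :+ r) :* con 1 := b :+ (r :+ q :* b))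
        refl (suc B) q (suc (toℕ r)))
      (diagRepresents-++ (suc m) (replicate g (+ (suc B + 0))) (blockCoeffs g B (λ i → suc B + suc i))
        (diagRepresents-replicate (suc B + 0) q)
        (diagRepresents-block {B} (λ i → suc B + suc i) (toℕ<n r) 1))

  QB-represents-outsideGap : ∀ B a → OutsideGap B a → Represents (QB (suc m) g B) a
  QB-represents-outsideGap B (+ zero)    _ = diagRepresents-zero m (coeffs (QB (suc m) g B))
  QB-represents-outsideGap B (+ suc n)   (_ , ∉[1,B]) with B <? suc n
  ... | no  B≮n = ⊥-elim (∉[1,B] (ℤ.+≤+ (s≤s z≤n) , ℤ.+≤+ (≮⇒≥ B≮n)))
  ... | yes B<n with m≤n⇒∃[o]m+o≡n B<n
  ...   | d , refl = QB-represents-≥ B d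
  QB-represents-outsideGap B ℤ.-[1+ n ] (() , _)

proposition3p3 : ∀ (m B g : ℕ) → 2 < m → 2 ∣ m → 1 ≤ B → IsWaringNumber m g →
    PositiveDefinite (QB m g B)
    × (∀ (a : ℤ) → Represents (QB m g B) a ⇔ ((+ 0 ≤ℤ a) × ¬ ((+ 1 ≤ℤ a) × (a ≤ℤ + B))))
    × (DiagForm.rank (QB m g B) ≡ suc B * g)
proposition3p3 _ B g () (divides zero refl) _ _
proposition3p3 _ B g _ (divides (suc k) refl) _ (waring , _) =
  QB-positiveDefinite (suc k) g B ,
  (λ a → mk⇔ (QB-represented⇒outsideGap (suc k) g B a) (QB-represents-outsideGap (suc (k * 2)) waring B a)) ,
  refl
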